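{- If there exists an $(n,m,k,\lambda)$-strong external difference family (in some additive abelian group of order $n$), then its parameters satisfy at least one of the following: (i) $\lambda=1$; (ii) $m=2$; (iii) $k=\lambda+1$ and $m\leq \lambda^2+1$; (iv) $k>\lambda+1$ and $m\leq (\lambda-1)k+2$; (v) $m\geq 5$, $2\leq\lambda\leq m-2$ and $k\leq (\lambda-1)(m-1)+1$.
   Context: For disjoint subsets $A,B$ of an additive abelian group $G$, let $\mathcal{D}(A,B)$ denote the multiset $\{x-y : x\in A,\ y\in B\}$. An $(n,m,k,\lambda)$-strong external difference family (SEDF) in an additive abelian group $G$ of order $n$ is a set of $m\geq 2$ pairwise disjoint $k$-subsets $A_1,\dots,A_m$ of $G$ such that for every $i$, $1\le i\le m$, the multiset union $\bigcup_{j\neq i}\mathcal{D}(A_i,A_j)$ equals $\lambda(G\setminus\{0\})$, i.e. contains every nonzero element of $G$ exactly $\lambda$ times. -}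

module Defs where

open import Level using (0ℓ)
open import Data.Nat using (ℕ; _≤_; _+_)
open import Data.Fin using (Fin)
open import Data.Fin.Properties using (_≟_)
open import Data.Fin.Subset using (Subset; _∈_; ∣_∣)
open import Data.Fin.Subset.Properties using (_∈?_)
open import Data.List using (List; allFin; map; concatMap)
open import Data.Nat.ListAction using (sum)
open import Data.Empty using (⊥)
open import Data.Product using (Σ)
open import Data.Bool using (if_then_else_; _∧_; not)
open import Relation.Nullary using (¬_; does)
open import Relation.Binary.PropositionalEquality using (_≡_; _≢_)
open import Algebra.Structures using (IsAbelianGroup)

-- An additive abelian group of order n, presented with carrier Fin n
-- (every group of order n is isomorphic to one of this form).
record FinAbGroup (n : ℕ) : Set where
  field
    _⊕_ : Fin n → Fin n → Fin n
    𝟘 : Fin n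
    ⊖_ : Fin n → Fin n
    isAbelianGroup : IsAbelianGroup _≡_ _⊕_ 𝟘 ⊖_

  _⊝_ : Fin n → Fin n → Fin n
  x ⊝ y = x ⊕ (⊖ y)

-- Multiplicity of g in the multiset  ⋃_{j ≠ i} D(A_i, A_j),
-- where D(A,B) = { x - y : x ∈ A, y ∈ B } (as a multiset).
diffCount : ∀ {n m} → FinAbGroup n → (Fin m → Subset n) → Fin m → Fin n → ℕ
diffCount {n} {m} G A i g =
  sum (concatMap (λ j → concatMap (λ x → map (λ y →
        if not (does (j ≟ i)) ∧ does (x ∈? A i) ∧ does (y ∈? A j)
             ∧ does ((x ⊝ y) ≟ g)
        then 1 else 0) (allFin n)) (allFin n)) (allFin m))
  where open FinAbGroup G

record IsSEDF {n : ℕ} (G : FinAbGroup n) (m k lam : ℕ) (A : Fin m → Subset n) : Set where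
  open FinAbGroup G
  field
    two≤m    : 2 ≤ m
    size     : ∀ i → ∣ A i ∣ ≡ k
    disjoint : ∀ i j → i ≢ j → ∀ x → x ∈ A i → x ∈ A j → ⊥
    zeroMult : ∀ i → diffCount G A i 𝟘 ≡ 0
    mult     : ∀ i g → g ≢ 𝟘 → diffCount G A i g ≡ lam

SEDFExists : ℕ → ℕ → ℕ → ℕ → Set
SEDFExists n m k lam =
  Σ (FinAbGroup n) λ G → Σ (Fin m → Subset n) λ A → IsSEDF G m k lam A

module Submission where

-- Fix one set A_i of an (n,m,k,λ)-SEDF in G and count the
-- triples (A_j, x, y) with j ≠ i, x ∈ A_i, y ∈ A_j in two ways: each such
-- triple contributes exactly one difference x - y, so summing the
-- multiplicities of all g ∈ G gives (m-1)k², while the SEDF condition says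
-- the same sum is λ(n-1).  Disjointness of the m sets of size k inside G
-- gives mk ≤ n.  From
--     (m-1)k² = λ(n-1)   and   mk ≤ n
-- elementary arithmetic shows that λ = 0 is impossible and that λ ≥ 2
-- forces k ≥ λ+1; the five alternatives of the corollary are then a case
-- split on k = λ+1 versus k > λ+1 and on the size of m.

open import Defs
open import Data.Nat using (ℕ; zero; suc; z≤n; s≤s; _≤_; _<_; _+_; _*_; _∸_; _≤?_; _<?_; >-nonZero)
open import Data.Product using (_×_; _,_)
open import Data.Sum using (_⊎_; inj₁; inj₂)
open import Relation.Binary.PropositionalEquality
  using (_≡_; _≢_; refl; sym; trans; cong; subst; module ≡-Reasoning)
open import Data.Nat.Properties
  using (+-*-semiring; ≤-trans; ≤-antisym; ≤-reflexive; ≤-pred; <⇒≱; <⇒≤; ≰⇒>; *-mono-≤; ≮⇒≥; m<m*n;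
         m≤n*m; +-mono-≤; m≤m+n; n≤1+n; m≤n⇒m<n∨m≡n; +-monoʳ-≤; *-monoʳ-≤;
         *-monoˡ-≤; +-cancelʳ-≤; *-cancelˡ-≤; +-comm; *-comm; *-suc;
         *-identityʳ; *-zeroʳ; *-distribˡ-+; module ≤-Reasoning)
open import Data.Nat.Tactic.RingSolver using (solve-∀)
import Data.Nat.ListAction as ListAction
open import Data.Nat.ListAction.Properties using (sum-++)
open import Data.Fin using (Fin; zero; suc)
open import Data.Fin.Properties using (_≟_; suc-injective)
open import Data.Fin.Subset using (Subset; _∈_; ∣_∣)
open import Data.Fin.Subset.Properties using (_∈?_)
open import Data.List using (List; map; concatMap; tabulate; allFin)
open import Data.Vec using ([]; _∷_)
open import Data.Bool using (Bool; true; false; if_then_else_; _∧_; not)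
open import Data.Empty using (⊥; ⊥-elim)
open import Relation.Nullary using (does; yes; no)
open import Algebra.Properties.Semiring.Sum +-*-semiring
  using (sum-syntax; sum-cong-≗; sum-replicate-zero; ∑-comm;
         *-distribˡ-sum; *-distribʳ-sum)

∑-*ˡ : ∀ {n} c (f : Fin n → ℕ) → ∑[ i < n ] (c * f i) ≡ c * ∑[ i < n ] f i
∑-*ˡ c f = sym (*-distribˡ-sum c f)

∑-*ʳ : ∀ {n} c (f : Fin n → ℕ) → ∑[ i < n ] (f i * c) ≡ ∑[ i < n ] f i * c
∑-*ʳ c f = sym (*-distribʳ-sum c f)

∑-const : ∀ n c → ∑[ i < n ] c ≡ n * c
∑-const zero c = refl
∑-const (suc n) c = cong (c +_) (∑-const n c)

∑-mono-≤ : ∀ {n} {f g : Fin n → ℕ} → (∀ i → f i ≤ g i) → ∑[ i < n ] f i ≤ ∑[ i < n ] g i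
∑-mono-≤ {zero} f≤g = z≤n
∑-mono-≤ {suc n} f≤g = +-mono-≤ (f≤g zero) (∑-mono-≤ (λ i → f≤g (suc i)))

∑-outer-to-inner : ∀ {a b c d} (f : Fin a → Fin b → Fin c → Fin d → ℕ) →
  ∑[ g < a ] ∑[ j < b ] ∑[ x < c ] ∑[ y < d ] f g j x y ≡
  ∑[ j < b ] ∑[ x < c ] ∑[ y < d ] ∑[ g < a ] f g j x y
∑-outer-to-inner {c = c} {d} f =
  trans (∑-comm (λ g j → ∑[ x < c ] ∑[ y < d ] f g j x y)) (sum-cong-≗ λ j →
  trans (∑-comm (λ g x → ∑[ y < d ] f g j x y)) (sum-cong-≗ λ x →
  ∑-comm (λ g y → f g j x y)))

sum-map-tabulate : ∀ {A : Set} n (g : Fin n → A) (f : A → ℕ) →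
  ListAction.sum (map f (tabulate g)) ≡ ∑[ i < n ] f (g i)
sum-map-tabulate zero g f = refl
sum-map-tabulate (suc n) g f = cong (f (g zero) +_) (sum-map-tabulate n (λ i → g (suc i)) f)

sum-concatMap-tabulate : ∀ {A : Set} n (g : Fin n → A) (f : A → List ℕ) →
  ListAction.sum (concatMap f (tabulate g)) ≡ ∑[ i < n ] ListAction.sum (f (g i))
sum-concatMap-tabulate zero g f = refl
sum-concatMap-tabulate (suc n) g f =
  trans (sum-++ (f (g zero)) _)
        (cong (ListAction.sum (f (g zero)) +_) (sum-concatMap-tabulate n (λ i → g (suc i)) f))

𝟙 : Bool → ℕ
𝟙 b = if b then 1 else 0

∑-point : ∀ {n} (d : Fin n) → ∑[ g < n ] 𝟙 (does (d ≟ g)) ≡ 1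
∑-point {suc n} zero = cong suc (sum-replicate-zero n)
∑-point {suc n} (suc d) = ∑-point d

∑-others : ∀ {n} (d : Fin n) → ∑[ g < n ] 𝟙 (not (does (g ≟ d))) ≡ n ∸ 1
∑-others {suc n} zero = trans (∑-const n 1) (*-identityʳ n)
∑-others {suc (suc n)} (suc d) = cong suc (∑-others d)

∑-atMostOne : ∀ {n} (b : Fin n → Bool) →
  (∀ g g' → b g ≡ true → b g' ≡ true → g ≡ g') → ∑[ g < n ] 𝟙 (b g) ≤ 1
∑-atMostOne {zero} b unique = z≤n
∑-atMostOne {suc n} b unique with b zero in b₀
... | true = s≤s (≤-reflexive (trans (sum-cong-≗ rest-absent) (sum-replicate-zero n)))
  where
  rest-absent : ∀ g → 𝟙 (b (suc g)) ≡ 0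
  rest-absent g with b (suc g) in b₁
  ... | true with () ← unique zero (suc g) b₀ b₁
  ... | false = refl
... | false = ∑-atMostOne (λ g → b (suc g))
                (λ g g' p q → suc-injective (unique (suc g) (suc g') p q))

∣p∣≡∑ : ∀ {n} (p : Subset n) → ∣ p ∣ ≡ ∑[ x < n ] 𝟙 (does (x ∈? p))
∣p∣≡∑ [] = refl
∣p∣≡∑ (true ∷ p) = cong suc (∣p∣≡∑ p)
∣p∣≡∑ (false ∷ p) = ∣p∣≡∑ p

∑-guarded-point : ∀ {n} a b c (d : Fin n) →
  ∑[ g < n ] 𝟙 (a ∧ b ∧ c ∧ does (d ≟ g)) ≡ 𝟙 a * (𝟙 b * 𝟙 c)
∑-guarded-point {n} false b c d = sum-replicate-zero n
∑-guarded-point {n} true false c d = sum-replicate-zero n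
∑-guarded-point {n} true true false d = sum-replicate-zero n
∑-guarded-point true true true d = ∑-point d

module Counting {n m : ℕ} (G : FinAbGroup n) (A : Fin m → Subset n) where
  open FinAbGroup G using (𝟘; _⊝_)

  contributes : Fin m → Fin m → Fin n → Fin n → Fin n → Bool
  contributes i j x y g =
    not (does (j ≟ i)) ∧ does (x ∈? A i) ∧ does (y ∈? A j) ∧ does ((x ⊝ y) ≟ g)

  diffCount-∑ : ∀ i g →
    diffCount G A i g ≡ ∑[ j < m ] ∑[ x < n ] ∑[ y < n ] 𝟙 (contributes i j x y g)
  diffCount-∑ i g =
    trans (sum-concatMap-tabulate m (λ j → j) (λ j → concatMap (row j) (allFin n)))
          (sum-cong-≗ λ j →
    trans (sum-concatMap-tabulate n (λ x → x) (row j))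
          (sum-cong-≗ λ x →
    sum-map-tabulate n (λ y → y) (λ y → 𝟙 (contributes i j x y g))))
    where
    row : Fin m → Fin n → List ℕ
    row j x = map (λ y → 𝟙 (contributes i j x y g)) (allFin n)

  -- Counting the triples (j, x, y) with j ≠ i, x ∈ A_i, y ∈ A_j: every one
  -- of them yields exactly one difference, so the multiplicities of all
  -- g ∈ G add up to (m-1)k².
  ∑-diffCount : ∀ {k} → (∀ j → ∣ A j ∣ ≡ k) → ∀ i →
    ∑[ g < n ] diffCount G A i g ≡ (m ∸ 1) * (k * k)
  ∑-diffCount {k} size i = begin
      ∑[ g < n ] diffCount G A i g
    ≡⟨ sum-cong-≗ (diffCount-∑ i) ⟩
      ∑[ g < n ] ∑[ j < m ] ∑[ x < n ] ∑[ y < n ] 𝟙 (contributes i j x y g)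
    ≡⟨ ∑-outer-to-inner (λ g j x y → 𝟙 (contributes i j x y g)) ⟩
      ∑[ j < m ] ∑[ x < n ] ∑[ y < n ] ∑[ g < n ] 𝟙 (contributes i j x y g)
    ≡⟨ sum-cong-≗ (λ j → sum-cong-≗ λ x → sum-cong-≗ λ y →
         ∑-guarded-point (not (does (j ≟ i))) (does (x ∈? A i)) (does (y ∈? A j)) (x ⊝ y)) ⟩
      ∑[ j < m ] ∑[ x < n ] ∑[ y < n ] (other j * (member i x * member j y))
    ≡⟨ sum-cong-≗ (λ j → sum-cong-≗ λ x →
         trans (∑-*ˡ (other j) (λ y → member i x * member j y)) (cong (other j *_)
         (trans (∑-*ˡ (member i x) (member j)) (cong (member i x *_) (size-∑ j))))) ⟩
      ∑[ j < m ] ∑[ x < n ] (other j * (member i x * k))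
    ≡⟨ sum-cong-≗ (λ j →
         trans (∑-*ˡ (other j) (λ x → member i x * k)) (cong (other j *_)
         (trans (∑-*ʳ k (member i)) (cong (_* k) (size-∑ i))))) ⟩
      ∑[ j < m ] (other j * (k * k))
    ≡⟨ ∑-*ʳ (k * k) other ⟩
      ∑[ j < m ] other j * (k * k)
    ≡⟨ cong (_* (k * k)) (∑-others i) ⟩
      (m ∸ 1) * (k * k) ∎
    where
    open ≡-Reasoning
    other : Fin m → ℕ
    other j = 𝟙 (not (does (j ≟ i)))
    member : Fin m → Fin n → ℕ
    member j x = 𝟙 (does (x ∈? A j))
    size-∑ : ∀ j → ∑[ y < n ] member j y ≡ k
    size-∑ j = trans (sym (∣p∣≡∑ (A j))) (size j)

  ∑-diffCount-SEDF : ∀ {k lam} → IsSEDF G m k lam A → ∀ i →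
    ∑[ g < n ] diffCount G A i g ≡ lam * (n ∸ 1)
  ∑-diffCount-SEDF {lam = lam} sedf i =
    trans (sum-cong-≗ multiplicity)
          (trans (∑-*ˡ lam (λ g → 𝟙 (not (does (g ≟ 𝟘))))) (cong (lam *_) (∑-others 𝟘)))
    where
    open IsSEDF sedf using (zeroMult; mult)
    multiplicity : ∀ g → diffCount G A i g ≡ lam * 𝟙 (not (does (g ≟ 𝟘)))
    multiplicity g with g ≟ 𝟘
    ... | yes refl = trans (zeroMult i) (sym (*-zeroʳ lam))
    ... | no g≢𝟘 = trans (mult i g g≢𝟘) (sym (*-identityʳ lam))

  packing : ∀ {k} → (∀ j → ∣ A j ∣ ≡ k) →
    (∀ i j → i ≢ j → ∀ x → x ∈ A i → x ∈ A j → ⊥) → m * k ≤ n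
  packing {k} size disjoint = begin
      m * k
    ≡⟨ sym (∑-const m k) ⟩
      ∑[ j < m ] k
    ≡⟨ sum-cong-≗ (λ j → trans (sym (size j)) (∣p∣≡∑ (A j))) ⟩
      ∑[ j < m ] ∑[ x < n ] member j x
    ≡⟨ ∑-comm member ⟩
      ∑[ x < n ] ∑[ j < m ] member j x
    ≤⟨ ∑-mono-≤ (λ x → ∑-atMostOne (λ j → does (x ∈? A j)) (unique-owner x)) ⟩
      ∑[ x < n ] 1
    ≡⟨ trans (∑-const n 1) (*-identityʳ n) ⟩
      n ∎
    where
    open ≤-Reasoning
    member : Fin m → Fin n → ℕ
    member j x = 𝟙 (does (x ∈? A j))
    unique-owner : ∀ x j j' → does (x ∈? A j) ≡ true → does (x ∈? A j') ≡ true → j ≡ j'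
    unique-owner x j j' _ _ with x ∈? A j | x ∈? A j' | j ≟ j'
    ... | yes x∈Aj | yes x∈Aj' | yes j≡j' = j≡j'
    ... | yes x∈Aj | yes x∈Aj' | no j≢j' = ⊥-elim (disjoint j j' j≢j' x x∈Aj x∈Aj')

sedf-conditions : ∀ {n m k lam} {G : FinAbGroup n} {A : Fin m → Subset n} →
  IsSEDF G m k lam A → (m ∸ 1) * (k * k) ≡ lam * (n ∸ 1) × m * k ≤ n
sedf-conditions {G = G} {A} sedf with IsSEDF.two≤m sedf
... | s≤s _ =
  trans (sym (∑-diffCount size zero)) (∑-diffCount-SEDF sedf zero) , packing size disjoint
  where
  open IsSEDF sedf using (size; disjoint)
  open Counting G A

*-square-rearrange : ∀ N k → N * (k * k) ≡ k * (N * k)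
*-square-rearrange = solve-∀

-- Indeed k ≤ λ would give  λmk ≤ λn = (m-1)k² + λ ≤ λ(m-1)k + λ,  so
-- k = 1; but then m-1 = λ(n-1) > n-1 ≥ m-1 (as n-1 ≥ m-1 ≥ 1).
lam<k : ∀ {m n k lam} → 2 ≤ lam → 2 ≤ m → 1 ≤ k →
  (m ∸ 1) * (k * k) ≡ lam * (n ∸ 1) → m * k ≤ n → lam < k
lam<k {suc N} {zero} {suc _} _ _ _ _ ()
lam<k {suc N} {suc N'} {k} {lam} (s≤s (s≤s _)) (s≤s 1≤N) 1≤k counting packing
  with lam <? k
... | yes lam<k = lam<k
... | no lam≮k = ⊥-elim (k≢1 (≤-antisym (k≤1 (≮⇒≥ lam≮k)) 1≤k))
  where
  k≤1 : k ≤ lam → k ≤ 1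
  k≤1 k≤lam = *-cancelˡ-≤ lam (+-cancelʳ-≤ (lam * (N * k)) (lam * k) (lam * 1) (begin
      lam * k + lam * (N * k)  ≡⟨ sym (*-distribˡ-+ lam k (N * k)) ⟩
      lam * (suc N * k)        ≤⟨ *-monoʳ-≤ lam packing ⟩
      lam * suc N'             ≡⟨ *-suc lam N' ⟩
      lam + lam * N'           ≡⟨ cong (lam +_) (sym counting) ⟩
      lam + N * (k * k)        ≡⟨ cong (lam +_) (*-square-rearrange N k) ⟩
      lam + k * (N * k)        ≤⟨ +-monoʳ-≤ lam (*-monoˡ-≤ (N * k) k≤lam) ⟩
      lam + lam * (N * k)      ≡⟨ cong (_+ lam * (N * k)) (sym (*-identityʳ lam)) ⟩
      lam * 1 + lam * (N * k)  ∎))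
    where open ≤-Reasoning
  k≢1 : k ≢ 1
  k≢1 refl = <⇒≱ (m<m*n N' lam ⦃ >-nonZero (≤-trans 1≤N N≤N') ⦄ (s≤s (s≤s z≤n))) (begin
      N' * lam  ≡⟨ *-comm N' lam ⟩
      lam * N'  ≡⟨ sym counting ⟩
      N * 1     ≡⟨ *-identityʳ N ⟩
      N         ≤⟨ N≤N' ⟩
      N'        ∎)
    where
    open ≤-Reasoning
    N≤N' : N ≤ N'
    N≤N' = subst (_≤ N') (*-identityʳ N) (≤-pred packing)

-- Alternative (v), written for λ = l + 1: if m exceeds (λ-1)k + 2 (with
-- λ ≥ 2, k > λ) then m ≥ k + 3, which makes all inequalities of (v) immediate.
large-m : ∀ {m k l} → 2 ≤ suc l → suc l < k → l * k + 2 < m →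
  5 ≤ m × 2 ≤ suc l × suc l ≤ m ∸ 2 × k ≤ l * (m ∸ 1) + 1
large-m {l = zero} (s≤s ()) _ _
large-m {m} {k} {l@(suc _)} 2≤lam lam<k big = from-k+3≤m (begin
    3 + k            ≤⟨ +-monoʳ-≤ 3 (m≤n*m k l) ⟩
    3 + l * k        ≡⟨ cong suc (+-comm 2 (l * k)) ⟩
    suc (l * k + 2)  ≤⟨ big ⟩
    m                ∎)
  where
  open ≤-Reasoning
  from-k+3≤m : ∀ {m} → 3 + k ≤ m →
    5 ≤ m × 2 ≤ suc l × suc l ≤ m ∸ 2 × k ≤ l * (m ∸ 1) + 1
  from-k+3≤m {suc (suc (suc M))} (s≤s (s≤s (s≤s k≤M))) =
      s≤s (s≤s (s≤s (≤-trans 2≤lam lam≤M)))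
    , 2≤lam
    , s≤s (≤-trans (n≤1+n l) lam≤M)
    , (begin
        k                          ≤⟨ k≤M ⟩
        M                          ≤⟨ ≤-trans (n≤1+n M) (n≤1+n (suc M)) ⟩
        suc (suc M)                ≤⟨ m≤n*m (suc (suc M)) l ⟩
        l * suc (suc M)            ≤⟨ m≤m+n _ 1 ⟩
        l * suc (suc M) + 1        ∎)
    where
    lam≤M : suc l ≤ M
    lam≤M = ≤-trans (<⇒≤ lam<k) k≤M

l*[l+2]+2≡[l+1]²+1 : ∀ l → l * (suc l + 1) + 2 ≡ suc l * suc l + 1
l*[l+2]+2≡[l+1]²+1 = solve-∀

parameter-cases : ∀ {m k lam} → 2 ≤ lam → lam < k →
    (k ≡ lam + 1 × m ≤ lam * lam + 1)
  ⊎ (lam + 1 < k × m ≤ (lam ∸ 1) * k + 2)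
  ⊎ (5 ≤ m × 2 ≤ lam × lam ≤ m ∸ 2 × k ≤ (lam ∸ 1) * (m ∸ 1) + 1)
parameter-cases {m} {k} {suc l} 2≤lam lam<k with m ≤? l * k + 2
... | no m≰ = inj₂ (inj₂ (large-m 2≤lam lam<k (≰⇒> m≰)))
... | yes m≤ with m≤n⇒m<n∨m≡n (subst (_≤ k) (+-comm 1 (suc l)) lam<k)
...   | inj₁ lam+1<k = inj₂ (inj₁ (lam+1<k , m≤))
...   | inj₂ refl = inj₁ (refl , subst (m ≤_) (l*[l+2]+2≡[l+1]²+1 l) m≤)

corollary3p6 : (n m k lam : ℕ) → 1 ≤ k → SEDFExists n m k lam →
    (lam ≡ 1)
    ⊎ (m ≡ 2)
    ⊎ (k ≡ lam + 1 × m ≤ lam * lam + 1)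
    ⊎ (lam + 1 < k × m ≤ (lam ∸ 1) * k + 2)
    ⊎ (5 ≤ m × 2 ≤ lam × lam ≤ m ∸ 2 × k ≤ (lam ∸ 1) * (m ∸ 1) + 1)
corollary3p6 n m k lam 1≤k (G , A , sedf) with sedf-conditions sedf | IsSEDF.two≤m sedf
corollary3p6 _ m k zero 1≤k _ | counting , _ | s≤s (s≤s _) =
  ⊥-elim (<⇒≱ (*-mono-≤ {y = m ∸ 1} (s≤s z≤n) (*-mono-≤ 1≤k 1≤k)) (≤-reflexive counting))
corollary3p6 _ _ _ (suc zero) _ _ | _ | _ = inj₁ refl
corollary3p6 _ _ _ lam@(suc (suc _)) 1≤k _ | counting , packing | 2≤m =
  inj₂ (inj₂ (parameter-cases 2≤lam (lam<k 2≤lam 2≤m 1≤k counting packing)))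
  where
  2≤lam : 2 ≤ lam
  2≤lam = s≤s (s≤s z≤n)
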